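{- Let $n\ge 0$ and let $S\subseteq \mathbb{F}_2^n$ be a nonempty complete set of cards with $|S|=\ell$. Then $\ell$ is a power of $2$. Moreover, for every $\ell$ that is a power of $2$, there exists a complete set of $\ell$ cards (in an EvenQuads deck of size $2^n$ for any $n$ with $2^n\ge \ell$).
   Context: An EvenQuads deck of size $2^n$ is the set $\mathbb{F}_2^n$; its elements are called cards (cards are sometimes labeled by integers $0,\dots,2^n-1$, identified with vectors via binary representation). A quad is a $4$-element subset $\{a,b,c,d\}$ of the deck with $a+b+c+d=0$ (equivalently, the bitwise XOR of the four labels is $0$). Any three distinct cards $a,b,c$ are completed to a quad by the unique fourth card $a+b+c$. A set $S$ of cards is called complete if for any three distinct cards $a,b,c\in S$ the card $a+b+c$ completing them to a quad also lies in $S$. -}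

module Defs where

open import Data.Nat using (ℕ)
open import Data.Bool using (Bool; _xor_)
open import Data.Vec using (Vec; zipWith)
open import Data.List using (List)
open import Data.List.Membership.Propositional using (_∈_)
open import Relation.Binary.PropositionalEquality using (_≢_)

-- A card of the EvenQuads deck of size 2^n: a vector in F_2^n,
-- with F_2 represented by Bool (false = 0, true = 1, addition = xor).
Card : ℕ → Set
Card n = Vec Bool n

_⊕_ : ∀ {n} → Card n → Card n → Card n
_⊕_ = zipWith _xor_

infixl 6 _⊕_

-- A set of cards is represented by a duplicate-free list (see Statement).
-- Complete: for any three distinct cards a, b, c in S, the card a + b + c
-- completing them to a quad also lies in S.
Complete : ∀ {n} → List (Card n) → Set
Complete {n} S =
  (a b c : Card n) → a ∈ S → b ∈ S → c ∈ S →
  a ≢ b → a ≢ c → b ≢ c → (a ⊕ b ⊕ c) ∈ S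

-- Split a complete set S ⊆ 𝔽₂ⁿ⁺¹ by its first coordinate. Each half is again
-- complete, and when both halves are nonempty, translating by a + c (a in one
-- half, c in the other) maps each half injectively into the other, so the
-- halves have equal size. By induction on n, |S| is 0 or a power of 2.
-- Conversely, 𝔽₂ᵏ × {0}ⁿ⁻ᵏ is closed under a + b + c, hence complete.
module Submission where

open import Defs
open import Data.Nat using (ℕ; zero; suc; _+_; _*_; _^_; _≤_; _<_; z≤n; s≤s)
open import Data.Nat.Properties
  using (+-suc; +-identityʳ; ≤-antisym; ≮⇒≥; <⇒≱; ^-monoʳ-<; m^n≡0⇒m≡0; module ≤-Reasoning)
open import Data.Bool using (Bool; true; false; _xor_)
open import Data.Bool.Properties using (xor-same; xor-assoc; xor-identityʳ)
  renaming (_≟_ to _≟ᵇ_)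
open import Data.Vec using ([]; _∷_; replicate)
open import Data.Vec.Properties using (∷-injective; ∷-injectiveʳ; ≡-dec)
open import Data.List using (List; []; _∷_; [_]; _++_; length; map; cartesianProductWith)
open import Data.List.Properties using (length-++; length-map; length-removeAt′)
open import Data.List.Relation.Unary.Any using (here; there; index; _─_)
open import Data.List.Relation.Unary.All using () renaming ([] to []ᵃ; _∷_ to _∷ᵃ_)
import Data.List.Relation.Unary.All as All
open import Data.List.Relation.Unary.AllPairs using ([]; _∷_)
open import Data.List.Relation.Unary.Unique.Propositional using (Unique)
import Data.List.Relation.Unary.Unique.Propositional.Properties as Unique
open import Data.List.Membership.Propositional using (_∈_)
open import Data.List.Membership.Propositional.Properties
  using (∈-map⁻; ∈-cartesianProductWith⁺; ∈-cartesianProductWith⁻)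
open import Data.List.Relation.Binary.Subset.Propositional using (_⊆_)
open import Data.Product using (_×_; _,_; proj₁; proj₂; ∃; ∃-syntax)
open import Data.Sum using (_⊎_; inj₁; inj₂)
open import Data.Empty using (⊥-elim)
open import Function using (_∘_)
open import Relation.Nullary using (Dec; yes; no)
open import Relation.Binary.PropositionalEquality
  using (_≡_; _≢_; refl; sym; trans; cong; cong₂; subst; module ≡-Reasoning)

⊕-self-inverseˡ : ∀ {n} (a b : Card n) → a ⊕ a ⊕ b ≡ b
⊕-self-inverseˡ []      []      = refl
⊕-self-inverseˡ (x ∷ a) (y ∷ b) = cong₂ _∷_ (cong (_xor y) (xor-same x)) (⊕-self-inverseˡ a b)

⊕-self-inverseʳ : ∀ {n} (a b : Card n) → a ⊕ b ⊕ b ≡ a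
⊕-self-inverseʳ []      []      = refl
⊕-self-inverseʳ (x ∷ a) (y ∷ b) = cong₂ _∷_ x⊕y⊕y≡x (⊕-self-inverseʳ a b)
  where
  x⊕y⊕y≡x : (x xor y) xor y ≡ x
  x⊕y⊕y≡x = trans (xor-assoc x y y) (trans (cong (x xor_) (xor-same y)) (xor-identityʳ x))

⊕-cancelʳ-≡ : ∀ {n} (c : Card n) {a b : Card n} → a ⊕ c ≡ b ⊕ c → a ≡ b
⊕-cancelʳ-≡ c {a} {b} eq = begin
  a         ≡⟨ sym (⊕-self-inverseʳ a c) ⟩
  a ⊕ c ⊕ c ≡⟨ cong (_⊕ c) eq ⟩
  b ⊕ c ⊕ c ≡⟨ ⊕-self-inverseʳ b c ⟩
  b         ∎
  where open ≡-Reasoning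

_≟_ : ∀ {n} (a b : Card n) → Dec (a ≡ b)
_≟_ = ≡-dec _≟ᵇ_

module _ {A : Set} where

  ∈-─⁺ : ∀ {x z : A} {ys} (x∈ys : x ∈ ys) → z ∈ ys → z ≢ x → z ∈ (ys ─ x∈ys)
  ∈-─⁺ (here refl)  (here refl)  z≢x = ⊥-elim (z≢x refl)
  ∈-─⁺ (here refl)  (there z∈ys) _   = z∈ys
  ∈-─⁺ (there _)    (here z≡y)   _   = here z≡y
  ∈-─⁺ (there x∈ys) (there z∈ys) z≢x = there (∈-─⁺ x∈ys z∈ys z≢x)

  length-mono-≤ : ∀ {xs ys : List A} → Unique xs → xs ⊆ ys → length xs ≤ length ys
  length-mono-≤ []                            _     = z≤n
  length-mono-≤ {x ∷ xs} {ys} (x∉xs ∷ xs!) xs⊆ys = begin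
    suc (length xs)          ≤⟨ s≤s (length-mono-≤ xs! xs⊆ys─x) ⟩
    suc (length (ys ─ x∈ys)) ≡⟨ sym (length-removeAt′ ys (index x∈ys)) ⟩
    length ys                ∎
    where
    open ≤-Reasoning
    x∈ys = xs⊆ys (here refl)
    xs⊆ys─x : xs ⊆ (ys ─ x∈ys)
    xs⊆ys─x z∈xs = ∈-─⁺ x∈ys (xs⊆ys (there z∈xs)) (λ z≡x → All.lookup x∉xs z∈xs (sym z≡x))

  ∃-∈ : ∀ {xs : List A} → length xs ≢ 0 → ∃ (_∈ xs)
  ∃-∈ {[]}    ≢0 = ⊥-elim (≢0 refl)
  ∃-∈ {x ∷ _} _  = x , here refl

ZeroOrPowerOf2 : ℕ → Set
ZeroOrPowerOf2 m = m ≡ 0 ⊎ ∃[ k ] m ≡ 2 ^ k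

2^k≢0 : ∀ k → 2 ^ k ≢ 0
2^k≢0 k eq with m^n≡0⇒m≡0 2 k eq
... | ()

+-zeroOrPowerOf2 : ∀ {m n} → ZeroOrPowerOf2 m → ZeroOrPowerOf2 n →
                   (m ≢ 0 → n ≢ 0 → m ≡ n) → ZeroOrPowerOf2 (m + n)
+-zeroOrPowerOf2     (inj₁ refl)         n?                _  = n?
+-zeroOrPowerOf2 {m} (inj₂ (k , m≡2^k)) (inj₁ refl)        _  = inj₂ (k , trans (+-identityʳ m) m≡2^k)
+-zeroOrPowerOf2     (inj₂ (k , refl))  (inj₂ (j , refl)) eq = inj₂ (suc k , cong (2 ^ k +_) 2^j≡2^k+0)
  where
  2^j≡2^k+0 : 2 ^ j ≡ 2 ^ k + 0
  2^j≡2^k+0 = trans (sym (eq (2^k≢0 k) (2^k≢0 j))) (sym (+-identityʳ (2 ^ k)))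

^-cancelʳ-≤ : ∀ m k n → 1 < m → m ^ k ≤ m ^ n → k ≤ n
^-cancelʳ-≤ m k n 1<m mᵏ≤mⁿ = ≮⇒≥ (λ n<k → <⇒≱ (^-monoʳ-< m 1<m n<k) mᵏ≤mⁿ)

slice : ∀ {n} → Bool → List (Card (suc n)) → List (Card n)
slice _     []                 = []
slice false ((false ∷ v) ∷ S) = v ∷ slice false S
slice false ((true  ∷ _) ∷ S) = slice false S
slice true  ((false ∷ _) ∷ S) = slice true S
slice true  ((true  ∷ v) ∷ S) = v ∷ slice true S

module _ {n : ℕ} where

  ∈-slice⁻ : ∀ b (S : List (Card (suc n))) {v} → v ∈ slice b S → (b ∷ v) ∈ S
  ∈-slice⁻ false ((false ∷ _) ∷ S) (here refl) = here refl
  ∈-slice⁻ false ((false ∷ _) ∷ S) (there v∈)  = there (∈-slice⁻ false S v∈)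
  ∈-slice⁻ false ((true  ∷ _) ∷ S) v∈          = there (∈-slice⁻ false S v∈)
  ∈-slice⁻ true  ((false ∷ _) ∷ S) v∈          = there (∈-slice⁻ true S v∈)
  ∈-slice⁻ true  ((true  ∷ _) ∷ S) (here refl) = here refl
  ∈-slice⁻ true  ((true  ∷ _) ∷ S) (there v∈)  = there (∈-slice⁻ true S v∈)

  ∈-slice⁺ : ∀ b (S : List (Card (suc n))) {v} → (b ∷ v) ∈ S → v ∈ slice b S
  ∈-slice⁺ false ((false ∷ _) ∷ S) (here refl) = here refl
  ∈-slice⁺ false ((false ∷ _) ∷ S) (there bv∈) = there (∈-slice⁺ false S bv∈)
  ∈-slice⁺ false ((true  ∷ _) ∷ S) (there bv∈) = ∈-slice⁺ false S bv∈
  ∈-slice⁺ true  ((false ∷ _) ∷ S) (there bv∈) = ∈-slice⁺ true S bv∈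
  ∈-slice⁺ true  ((true  ∷ _) ∷ S) (here refl) = here refl
  ∈-slice⁺ true  ((true  ∷ _) ∷ S) (there bv∈) = there (∈-slice⁺ true S bv∈)

  length-slices : ∀ (S : List (Card (suc n))) →
                  length S ≡ length (slice false S) + length (slice true S)
  length-slices []                = refl
  length-slices ((false ∷ _) ∷ S) = cong suc (length-slices S)
  length-slices ((true  ∷ _) ∷ S) =
    trans (cong suc (length-slices S)) (sym (+-suc (length (slice false S)) _))

  slice-unique : ∀ b (S : List (Card (suc n))) → Unique S → Unique (slice b S)
  slice-unique _     []                _          = []
  slice-unique false ((false ∷ _) ∷ S) (v∉S ∷ S!) =
    All.tabulate (λ w∈ v≡w → All.lookup v∉S (∈-slice⁻ false S w∈) (cong (false ∷_) v≡w))
    ∷ slice-unique false S S!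
  slice-unique false ((true  ∷ _) ∷ S) (_ ∷ S!)   = slice-unique false S S!
  slice-unique true  ((false ∷ _) ∷ S) (_ ∷ S!)   = slice-unique true S S!
  slice-unique true  ((true  ∷ _) ∷ S) (v∉S ∷ S!) =
    All.tabulate (λ w∈ v≡w → All.lookup v∉S (∈-slice⁻ true S w∈) (cong (true ∷_) v≡w))
    ∷ slice-unique true S S!

  -- Two cards from slice b and one from slice b' complete to a card in slice b', as b + b + b' = b'.
  slice-closed : ∀ {S : List (Card (suc n))} {b b' x y z} → Complete S →
                 x ∈ slice b S → y ∈ slice b S → z ∈ slice b' S →
                 x ≢ y → (b ≡ b' → x ≢ z × y ≢ z) → (x ⊕ y ⊕ z) ∈ slice b' S
  slice-closed {S} {b} {b'} {x} {y} {z} complete x∈ y∈ z∈ x≢y distinct =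
    ∈-slice⁺ b' S (subst (_∈ S) b+b+b'≡b'
      (complete (b ∷ x) (b ∷ y) (b' ∷ z) (∈-slice⁻ b S x∈) (∈-slice⁻ b S y∈) (∈-slice⁻ b' S z∈)
        (x≢y ∘ ∷-injectiveʳ) (≢∷ proj₁) (≢∷ proj₂)))
    where
    b+b+b'≡b' : (b ∷ x) ⊕ (b ∷ y) ⊕ (b' ∷ z) ≡ b' ∷ (x ⊕ y ⊕ z)
    b+b+b'≡b' = cong (_∷ (x ⊕ y ⊕ z)) (cong (_xor b') (xor-same b))
    ≢∷ : ∀ {w} → ((x ≢ z × y ≢ z) → w ≢ z) → (b ∷ w) ≢ (b' ∷ z)
    ≢∷ pick eq with ∷-injective eq
    ... | b≡b' , w≡z = pick (distinct b≡b') w≡z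

  slice-complete : ∀ b (S : List (Card (suc n))) → Complete S → Complete (slice b S)
  slice-complete b S complete x y z x∈ y∈ z∈ x≢y x≢z y≢z =
    slice-closed complete x∈ y∈ z∈ x≢y (λ _ → x≢z , y≢z)

  length-slice-≤ : ∀ {b b'} (S : List (Card (suc n))) {a c} → b ≢ b' → Unique S → Complete S →
                   a ∈ slice b S → c ∈ slice b' S → length (slice b S) ≤ length (slice b' S)
  length-slice-≤ {b} {b'} S {a} {c} b≢b' S! complete a∈ c∈ = begin
    length (slice b S)                 ≡⟨ sym (length-map translate (slice b S)) ⟩
    length (map translate (slice b S)) ≤⟨ length-mono-≤ translate-unique translate-⊆ ⟩
    length (slice b' S)                ∎
    where
    open ≤-Reasoning
    translate : Card n → Card n
    translate v = v ⊕ a ⊕ c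
    translate-unique : Unique (map translate (slice b S))
    translate-unique = Unique.map⁺ (⊕-cancelʳ-≡ a ∘ ⊕-cancelʳ-≡ c) (slice-unique b S S!)
    translate-⊆ : map translate (slice b S) ⊆ slice b' S
    translate-⊆ w∈ with ∈-map⁻ translate w∈
    ... | v , v∈ , refl with v ≟ a
    ...   | yes refl = subst (_∈ slice b' S) (sym (⊕-self-inverseˡ v c)) c∈
    ...   | no v≢a   = slice-closed complete v∈ a∈ c∈ v≢a (⊥-elim ∘ b≢b')

  length-slices-≡ : ∀ (S : List (Card (suc n))) → Unique S → Complete S →
                    length (slice false S) ≢ 0 → length (slice true S) ≢ 0 →
                    length (slice false S) ≡ length (slice true S)
  length-slices-≡ S S! complete ≢0 ≢0' with ∃-∈ ≢0 | ∃-∈ ≢0'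
  ... | a , a∈ | c , c∈ =
    ≤-antisym (length-slice-≤ S (λ ()) S! complete a∈ c∈)
              (length-slice-≤ S (λ ()) S! complete c∈ a∈)

complete⇒zeroOrPowerOf2 : ∀ n (S : List (Card n)) → Unique S → Complete S →
                          ZeroOrPowerOf2 (length S)
complete⇒zeroOrPowerOf2 zero    []               _                   _ = inj₁ refl
complete⇒zeroOrPowerOf2 zero    (_ ∷ [])         _                   _ = inj₂ (0 , refl)
complete⇒zeroOrPowerOf2 zero    ([] ∷ [] ∷ _)    ((≢[] ∷ᵃ _) ∷ _)    _ = ⊥-elim (≢[] refl)
complete⇒zeroOrPowerOf2 (suc n) S S! complete =
  subst ZeroOrPowerOf2 (sym (length-slices S))
    (+-zeroOrPowerOf2 (halve false) (halve true) (length-slices-≡ S S! complete))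
  where
  halve : ∀ b → ZeroOrPowerOf2 (length (slice b S))
  halve b = complete⇒zeroOrPowerOf2 n (slice b S) (slice-unique b S S!) (slice-complete b S complete)

AffineClosed : ∀ {n} → List (Card n) → Set
AffineClosed {n} T = ∀ (a b c : Card n) → a ∈ T → b ∈ T → c ∈ T → (a ⊕ b ⊕ c) ∈ T

affineClosed⇒complete : ∀ {n} {T : List (Card n)} → AffineClosed T → Complete T
affineClosed⇒complete closed a b c a∈ b∈ c∈ _ _ _ = closed a b c a∈ b∈ c∈

singleton-affineClosed : ∀ {n} (z : Card n) → AffineClosed [ z ]
singleton-affineClosed z _ _ _ (here refl) (here refl) (here refl) = here (⊕-self-inverseˡ z z)

length-cartesianProductWith : ∀ {A B C : Set} (f : A → B → C) xs ys →
  length (cartesianProductWith f xs ys) ≡ length xs * length ys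
length-cartesianProductWith f []       ys = refl
length-cartesianProductWith f (x ∷ xs) ys = begin
  length (map (f x) ys ++ cartesianProductWith f xs ys)          ≡⟨ length-++ (map (f x) ys) ⟩
  length (map (f x) ys) + length (cartesianProductWith f xs ys)  ≡⟨ cong₂ _+_ (length-map (f x) ys)
                                                                      (length-cartesianProductWith f xs ys) ⟩
  length ys + length xs * length ys                              ∎
  where open ≡-Reasoning

bits : List Bool
bits = false ∷ true ∷ []

∈-bits : ∀ b → b ∈ bits
∈-bits false = here refl
∈-bits true  = there (here refl)

𝔽₂×_ : ∀ {n} → List (Card n) → List (Card (suc n))
𝔽₂× T = cartesianProductWith _∷_ bits T

𝔽₂×-unique : ∀ {n} {T : List (Card n)} → Unique T → Unique (𝔽₂× T)
𝔽₂×-unique = Unique.cartesianProductWith⁺ _∷_ ∷-injective (((λ ()) ∷ᵃ []ᵃ) ∷ []ᵃ ∷ [])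

𝔽₂×-affineClosed : ∀ {n} {T : List (Card n)} → AffineClosed T → AffineClosed (𝔽₂× T)
𝔽₂×-affineClosed {T = T} closed _ _ _ a∈ b∈ c∈
  with ∈-cartesianProductWith⁻ _∷_ bits T a∈
     | ∈-cartesianProductWith⁻ _∷_ bits T b∈
     | ∈-cartesianProductWith⁻ _∷_ bits T c∈
... | x , a , _ , a∈T , refl | y , b , _ , b∈T , refl | z , c , _ , c∈T , refl =
  ∈-cartesianProductWith⁺ _∷_ (∈-bits ((x xor y) xor z)) (closed a b c a∈T b∈T c∈T)

subcube : ∀ {k n} → k ≤ n → List (Card n)
subcube {n = n} z≤n = [ replicate n false ]
subcube (s≤s k≤n)   = 𝔽₂× subcube k≤n

subcube-unique : ∀ {k n} (k≤n : k ≤ n) → Unique (subcube k≤n)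
subcube-unique z≤n       = []ᵃ ∷ []
subcube-unique (s≤s k≤n) = 𝔽₂×-unique (subcube-unique k≤n)

subcube-affineClosed : ∀ {k n} (k≤n : k ≤ n) → AffineClosed (subcube k≤n)
subcube-affineClosed {n = n} z≤n = singleton-affineClosed (replicate n false)
subcube-affineClosed (s≤s k≤n)   = 𝔽₂×-affineClosed (subcube-affineClosed k≤n)

length-subcube : ∀ {k n} (k≤n : k ≤ n) → length (subcube k≤n) ≡ 2 ^ k
length-subcube z≤n       = refl
length-subcube (s≤s k≤n) =
  trans (length-cartesianProductWith _∷_ bits (subcube k≤n)) (cong (2 *_) (length-subcube k≤n))

mainTheorem1 :
    ((n : ℕ) (S : List (Card n)) → Unique S → S ≢ [] → Complete S →
      ∃[ k ] length S ≡ 2 ^ k)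
    ×
    ((k n : ℕ) → 2 ^ k ≤ 2 ^ n →
      ∃[ S ] (Unique {A = Card n} S × Complete S × length S ≡ 2 ^ k))
mainTheorem1 = powerOf2 , existence
  where
  powerOf2 : (n : ℕ) (S : List (Card n)) → Unique S → S ≢ [] → Complete S →
             ∃[ k ] length S ≡ 2 ^ k
  powerOf2 n []          _  S≢[] _        = ⊥-elim (S≢[] refl)
  powerOf2 n S@(_ ∷ _)   S! _    complete with complete⇒zeroOrPowerOf2 n S S! complete
  ... | inj₁ ()
  ... | inj₂ |S|≡2^k = |S|≡2^k

  existence : (k n : ℕ) → 2 ^ k ≤ 2 ^ n →
              ∃[ S ] (Unique {A = Card n} S × Complete S × length S ≡ 2 ^ k)
  existence k n 2^k≤2^n =
    subcube k≤n , subcube-unique k≤n , affineClosed⇒complete (subcube-affineClosed k≤n) , length-subcube k≤n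
    where
    k≤n : k ≤ n
    k≤n = ^-cancelʳ-≤ 2 k n (s≤s (s≤s z≤n)) 2^k≤2^n
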